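{- Let $G$ be a rotor graph. For any two particle configurations $\sigma,\sigma'$, we have $\sigma\sim\sigma'$ if and only if there exists a firing vector $r\in\mathbb{Z}^{V_0}$ with $\sigma'=\sigma+\Delta(r)$.
   Context: A rotor graph is a stopping directed multigraph $G=(V,A,\mathrm{head},\mathrm{tail})$ (every vertex has a directed path to a sink, i.e. a vertex of outdegree $0$) with a rotor order: a bijection $\theta:A\to A$ which, for each vertex $u$ in the set $V_0$ of non-sink vertices, permutes the set $A^+(u)$ of arcs out of $u$ as a single cycle. A rotor configuration is a map $\rho:V_0\to A$ with $\rho(u)\in A^+(u)$ ($\mathcal{R}$ is their set); a particle configuration is a map $\sigma:V\to\mathbb{Z}$ (a vertex $u$ is identified with the configuration with one particle on $u$). For $u\in V_0$, $\mathrm{routing}^+_u(\rho,\sigma)=(\rho',\sigma+\mathrm{head}(\rho(u))-u)$ where $\rho'$ equals $\rho$ except $\rho'(u)=\theta(\rho(u))$; these are commuting bijections; for $r:V_0\to\mathbb{Z}$, $\mathrm{routing}^r$ composes the $(\mathrm{routing}^+_u)^{r(u)}$ (negative powers = inverses). $(\rho,\sigma)\sim(\rho',\sigma')$ iff $\mathrm{routing}^r(\rho,\sigma)=(\rho',\sigma')$ for some $r$. Two particle configurations satisfy $\sigma\sim\sigma'$ iff there is $\rho\in\mathcal{R}$ with $(\rho,\sigma)\sim(\rho,\sigma')$. The Laplacian is the linear map $\Delta:\mathbb{Z}^{V_0}\to\mathbb{Z}^V$ with $\Delta(u)=\sum_{a\in A^+(u)}(\mathrm{head}(a)-\mathrm{tail}(a))$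 for $u\in V_0$, i.e. $\Delta(r)=\sum_{u\in V_0}r(u)\Delta(u)$. -}

module Defs where

open import Data.Nat as ℕ using (ℕ; zero; suc)
open import Data.Integer as ℤ using (ℤ; +_; -[1+_]; _+_; _-_; _*_)
open import Data.Fin as Fin using (Fin)
open import Data.Fin.Properties as FinP using ()
open import Data.Sum using (_⊎_; inj₁; inj₂)
open import Data.Product using (Σ; ∃; ∃-syntax; _×_; _,_; proj₁; proj₂)
open import Data.Bool using (Bool; true; false; if_then_else_)
open import Relation.Nullary using (does)
open import Relation.Binary.PropositionalEquality using (_≡_)

iter : {X : Set} → (X → X) → ℕ → X → X
iter f zero    x = x
iter f (suc k) x = f (iter f k x)

sumFin : (n : ℕ) → (Fin n → ℤ) → ℤ
sumFin zero    f = + 0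
sumFin (suc n) f = f Fin.zero + sumFin n (λ i → f (Fin.suc i))

-- directed reachability of a sink (vertices Fin n₀ ⊎ Fin k, the inj₂ ones
-- being the sinks; arcs Fin m with given head and tail)
data ReachesSink (n₀ k m : ℕ) (head : Fin m → Fin n₀ ⊎ Fin k) (tail : Fin m → Fin n₀)
       : Fin n₀ ⊎ Fin k → Set where
  sink : (s : Fin k) → ReachesSink n₀ k m head tail (inj₂ s)
  step : (a : Fin m) → ReachesSink n₀ k m head tail (head a)
       → ReachesSink n₀ k m head tail (inj₁ (tail a))

-- Vertices are V = V₀ ⊎ S where
-- V₀ = Fin n₀ are the non-sink vertices and S = Fin k the sinks.
-- Arcs are A = Fin m; every arc leaves a non-sink (sinks have outdegree 0),
-- so tail : A → V₀.
record RotorGraph : Set where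
  field
    n₀ k m : ℕ
  V : Set
  V = Fin n₀ ⊎ Fin k
  A : Set
  A = Fin m
  field
    head : A → V
    tail : A → Fin n₀
    nonsink : (u : Fin n₀) → ∃[ a ] tail a ≡ u
  field
    stopping : (v : V) → ReachesSink n₀ k m head tail v
    θ  : A → A
    θ⁻ : A → A
    θ-θ⁻ : (a : A) → θ (θ⁻ a) ≡ a
    θ⁻-θ : (a : A) → θ⁻ (θ a) ≡ a
    θ-tail : (a : A) → tail (θ a) ≡ tail a
    θ-cycle : (a b : A) → tail a ≡ tail b → ∃[ j ] iter θ j a ≡ b

module _ (G : RotorGraph) where
  open RotorGraph G

  _≟V_ : V → V → Bool
  inj₁ x ≟V inj₁ y = does (x FinP.≟ y)
  inj₁ x ≟V inj₂ y = false
  inj₂ x ≟V inj₁ y = false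
  inj₂ x ≟V inj₂ y = does (x FinP.≟ y)

  δ : V → V → ℤ
  δ v w = if v ≟V w then + 1 else + 0

  RotorMap : Set
  RotorMap = Fin n₀ → A

  IsRotorConfig : RotorMap → Set
  IsRotorConfig ρ = (u : Fin n₀) → tail (ρ u) ≡ u

  ParticleConfig : Set
  ParticleConfig = V → ℤ

  FiringVector : Set
  FiringVector = Fin n₀ → ℤ

  State : Set
  State = RotorMap × ParticleConfig

  update : RotorMap → Fin n₀ → A → RotorMap
  update ρ u a u' = if does (u' FinP.≟ u) then a else ρ u'

  routing⁺ : Fin n₀ → State → State
  routing⁺ u (ρ , σ) =
    update ρ u (θ (ρ u)) , (λ w → σ w + δ (head (ρ u)) w - δ (inj₁ u) w)

  routing⁻ : Fin n₀ → State → State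
  routing⁻ u (ρ , σ) =
    update ρ u (θ⁻ (ρ u)) , (λ w → σ w - δ (head (θ⁻ (ρ u))) w + δ (inj₁ u) w)

  routingPow : Fin n₀ → ℤ → State → State
  routingPow u (+ j)     = iter (routing⁺ u) j
  routingPow u -[1+ j ]  = iter (routing⁻ u) (suc j)

  routingAux : (j : ℕ) → (Fin j → Fin n₀) → (Fin j → ℤ) → State → State
  routingAux zero    ι r s = s
  routingAux (suc j) ι r s =
    routingPow (ι Fin.zero) (r Fin.zero) (routingAux j (λ i → ι (Fin.suc i)) (λ i → r (Fin.suc i)) s)

  routing : FiringVector → State → State
  routing r = routingAux n₀ (λ u → u) r

  _≈S_ : State → State → Set
  (ρ , σ) ≈S (ρ' , σ') = ((u : Fin n₀) → ρ u ≡ ρ' u) × ((v : V) → σ v ≡ σ' v)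

  _∼S_ : State → State → Set
  s ∼S s' = ∃[ r ] routing r s ≈S s'

  _∼_ : ParticleConfig → ParticleConfig → Set
  σ ∼ σ' = Σ RotorMap λ ρ → IsRotorConfig ρ × ((ρ , σ) ∼S (ρ , σ'))

  Δ₁ : Fin n₀ → ParticleConfig
  Δ₁ u w = sumFin m (λ a → if does (tail a FinP.≟ u)
                             then δ (head a) w - δ (inj₁ u) w
                             else + 0)

  Δ : FiringVector → ParticleConfig
  Δ r w = sumFin n₀ (λ u → r u * Δ₁ u w)

{-# OPTIONS --safe #-}
-- Fix a rotor configuration β and let the rotor order θ act on arcs by integer powers.
-- Routing from (β, σ) according to a firing vector J, in any order and without ever reducing
-- rotor positions modulo their cycles, leads to the state
--   lift J = (u ↦ θ^(J u) (β u) ,  σ + Σ_u D_u (J u)),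
-- where D_u is the discrete antiderivative of j ↦ head (θ^j (β u)) − u: a single routing step
-- changes one entry of J by ±1 and moves exactly the particle that D_u accounts for.
-- The rotor at u is back at β u exactly when J u is a multiple of its cycle length p_u, and one
-- full turn sends one particle along every arc out of u, so D_u (k p_u) = k Δ(u).  Hence a
-- return to the rotors of (ρ, σ) forces r = q·p and σ' = σ + Δ(q), while firing r·p from any
-- rotor configuration realises σ + Δ(r).
module Submission where

open import Defs
open import Data.Integer using (ℤ; _+_)
open import Data.Product using (∃-syntax)
open import Relation.Binary.PropositionalEquality using (_≡_)
open import Function.Bundles using (_⇔_)

open import Data.Bool using (if_then_else_)
open import Data.Fin as Fin using (Fin)
import Data.Fin.Properties as FinP
open import Data.Integer as ℤ using (+_; -[1+_]; -_; _-_; _*_; 0ℤ; 1ℤ; -1ℤ)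
open import Data.Integer.DivMod using (_%ℕ_; _/ℕ_; n%ℕd<d; a≡a%ℕn+[a/ℕn]*n)
import Data.Integer.Properties as ℤP
open import Algebra.Properties.AbelianGroup ℤP.+-0-abelianGroup using (∙-cancelʳ)
open import Algebra.Properties.CommutativeSemigroup ℤP.+-commutativeSemigroup
  using (interchange; xy∙z≈xz∙y; x∙yz≈y∙xz)
open import Data.Integer.Tactic.RingSolver using (solve-∀)
open import Data.Nat as ℕ using (ℕ; zero; suc; _<_; _≤_)
import Data.Nat.Properties as ℕP
open import Data.Product using (_×_; _,_; proj₁; proj₂)
open import Data.Sum using (inj₁; inj₂)
open import Function.Base using (_∘_)
open import Function.Bundles using (mk⇔)
open import Relation.Binary.Definitions using (DecidableEquality)
open import Relation.Binary.PropositionalEquality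
  using (refl; sym; trans; cong; cong₂; subst; _≢_; module ≡-Reasoning)
open import Relation.Nullary using (does; yes; no; ¬_; contradiction)
open import Relation.Nullary.Decidable using (dec-true; dec-false)
open import Relation.Unary using (Decidable)

open ≡-Reasoning

module _ {X : Set} (f : X → X) where

  iter-+ : ∀ m n x → iter f (m ℕ.+ n) x ≡ iter f m (iter f n x)
  iter-+ zero    n x = refl
  iter-+ (suc m) n x = cong f (iter-+ m n x)

  iter-comm : ∀ n x → iter f n (f x) ≡ f (iter f n x)
  iter-comm zero    x = refl
  iter-comm (suc n) x = cong f (iter-comm n x)

  iter-injective : (∀ {x y} → f x ≡ f y → x ≡ y) → ∀ n {x y} → iter f n x ≡ iter f n y → x ≡ y
  iter-injective f-inj zero    e = e
  iter-injective f-inj (suc n) e = iter-injective f-inj n (f-inj e)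

least-witness : ∀ {p} {P : ℕ → Set p} → Decidable P → ∀ {n} → P n →
                ∃[ k ] P k × (∀ {j} → j < k → ¬ P j)
least-witness P? {zero} p₀ = 0 , p₀ , λ ()
least-witness P? {suc n} pₙ with P? 0
... | yes p₀ = 0 , p₀ , λ ()
... | no ¬p₀ with least-witness (P? ∘ suc) pₙ
...   | k , pₖ , below = suc k , pₖ , λ { {zero} _ → ¬p₀ ; {suc j} j<k → below (ℕP.≤-pred j<k) }

partialSum : (ℕ → ℤ) → ℕ → ℤ
partialSum g zero    = 0ℤ
partialSum g (suc n) = partialSum g n + g n

partialSum-cong : ∀ {g h} n → (∀ {i} → i < n → g i ≡ h i) → partialSum g n ≡ partialSum h n
partialSum-cong zero    e = refl
partialSum-cong (suc n) e = cong₂ _+_ (partialSum-cong n (e ∘ ℕP.m<n⇒m<1+n)) (e (ℕP.n<1+n n))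

partialSum-zero : ∀ {g} n → (∀ {i} → i < n → g i ≡ 0ℤ) → partialSum g n ≡ 0ℤ
partialSum-zero zero    e = refl
partialSum-zero (suc n) e = cong₂ _+_ (partialSum-zero n (e ∘ ℕP.m<n⇒m<1+n)) (e (ℕP.n<1+n n))

partialSum-select : ∀ {g} n {k} → k < n → (∀ {i} → i < n → i ≢ k → g i ≡ 0ℤ) →
                    partialSum g n ≡ g k
partialSum-select {g} (suc n) {k} k<1+n others with k ℕP.≟ n
... | yes refl = begin
  partialSum g n + g n ≡⟨ cong (_+ g n) (partialSum-zero n λ i<n → others (ℕP.m<n⇒m<1+n i<n) (ℕP.<⇒≢ i<n)) ⟩
  0ℤ + g n             ≡⟨ ℤP.+-identityˡ (g n) ⟩
  g n                  ∎
... | no k≢n = begin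
  partialSum g n + g n ≡⟨ cong₂ _+_ (partialSum-select n k<n (others ∘ ℕP.m<n⇒m<1+n))
                                    (others (ℕP.n<1+n n) (k≢n ∘ sym)) ⟩
  g k + 0ℤ             ≡⟨ ℤP.+-identityʳ (g k) ⟩
  g k                  ∎
  where k<n = ℕP.≤∧≢⇒< (ℕP.≤-pred k<1+n) k≢n

sumFin-cong : ∀ n {f g : Fin n → ℤ} → (∀ i → f i ≡ g i) → sumFin n f ≡ sumFin n g
sumFin-cong zero    e = refl
sumFin-cong (suc n) e = cong₂ _+_ (e Fin.zero) (sumFin-cong n (e ∘ Fin.suc))

sumFin-zero : ∀ n → sumFin n (λ _ → 0ℤ) ≡ 0ℤ
sumFin-zero zero    = refl
sumFin-zero (suc n) = trans (ℤP.+-identityˡ _) (sumFin-zero n)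

sumFin-+ : ∀ n (f g : Fin n → ℤ) → sumFin n (λ i → f i + g i) ≡ sumFin n f + sumFin n g
sumFin-+ zero    f g = refl
sumFin-+ (suc n) f g = begin
  (f₀ + g₀) + sumFin n (λ i → f (Fin.suc i) + g (Fin.suc i)) ≡⟨ cong (_+_ (f₀ + g₀)) (sumFin-+ n _ _) ⟩
  (f₀ + g₀) + (∑f + ∑g)                                       ≡⟨ interchange f₀ g₀ ∑f ∑g ⟩
  (f₀ + ∑f) + (g₀ + ∑g)                                       ∎
  where
  f₀ = f Fin.zero
  g₀ = g Fin.zero
  ∑f = sumFin n (f ∘ Fin.suc)
  ∑g = sumFin n (g ∘ Fin.suc)

sumFin-select : ∀ n (v : Fin n) (F : Fin n → ℤ) →
                sumFin n (λ i → if does (v FinP.≟ i) then F i else 0ℤ) ≡ F v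
sumFin-select (suc n) Fin.zero F = begin
  F Fin.zero + sumFin n (λ _ → 0ℤ) ≡⟨ cong (_+_ (F Fin.zero)) (sumFin-zero n) ⟩
  F Fin.zero + 0ℤ                  ≡⟨ ℤP.+-identityʳ _ ⟩
  F Fin.zero                       ∎
sumFin-select (suc n) (Fin.suc v) F = begin
  0ℤ + sumFin n (λ i → if does (Fin.suc v FinP.≟ Fin.suc i) then F (Fin.suc i) else 0ℤ)
    ≡⟨ ℤP.+-identityˡ _ ⟩
  sumFin n (λ i → if does (Fin.suc v FinP.≟ Fin.suc i) then F (Fin.suc i) else 0ℤ)
    ≡⟨ sumFin-cong n (λ i → cong (if_then F (Fin.suc i) else 0ℤ) (does-suc≟suc i)) ⟩
  sumFin n (λ i → if does (v FinP.≟ i) then F (Fin.suc i) else 0ℤ)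
    ≡⟨ sumFin-select n v (F ∘ Fin.suc) ⟩
  F (Fin.suc v) ∎
  where
  does-suc≟suc : ∀ i → does (Fin.suc v FinP.≟ Fin.suc i) ≡ does (v FinP.≟ i)
  does-suc≟suc i with v FinP.≟ i
  ... | yes _ = refl
  ... | no  _ = refl

sumFin-update : ∀ n (u : Fin n) (H H′ : Fin n → ℤ) → (∀ v → v ≢ u → H′ v ≡ H v) →
                sumFin n H′ ≡ sumFin n H + (H′ u - H u)
sumFin-update (suc n) Fin.zero H H′ same = begin
  H′ Fin.zero + sumFin n (H′ ∘ Fin.suc) ≡⟨ cong (_+_ (H′ Fin.zero)) (sumFin-cong n λ i → same (Fin.suc i) λ ()) ⟩
  H′ Fin.zero + sumFin n (H ∘ Fin.suc)  ≡⟨ exchange (H Fin.zero) (sumFin n (H ∘ Fin.suc)) (H′ Fin.zero) ⟩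
  (H Fin.zero + sumFin n (H ∘ Fin.suc)) + (H′ Fin.zero - H Fin.zero) ∎
  where
  exchange : ∀ h s h′ → h′ + s ≡ (h + s) + (h′ - h)
  exchange = solve-∀
sumFin-update (suc n) (Fin.suc u) H H′ same = begin
  H′ Fin.zero + sumFin n (H′ ∘ Fin.suc)
    ≡⟨ cong₂ _+_ (same Fin.zero λ ())
                 (sumFin-update n u (H ∘ Fin.suc) (H′ ∘ Fin.suc) λ v v≢u →
                    same (Fin.suc v) (v≢u ∘ FinP.suc-injective)) ⟩
  H Fin.zero + (sumFin n (H ∘ Fin.suc) + (H′ (Fin.suc u) - H (Fin.suc u)))
    ≡⟨ ℤP.+-assoc (H Fin.zero) _ _ ⟨
  (H Fin.zero + sumFin n (H ∘ Fin.suc)) + (H′ (Fin.suc u) - H (Fin.suc u)) ∎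

sumFin-partialSum-comm : ∀ m n (e : ℕ → Fin m → ℤ) →
  sumFin m (λ a → partialSum (λ i → e i a) n) ≡ partialSum (λ i → sumFin m (e i)) n
sumFin-partialSum-comm m zero    e = sumFin-zero m
sumFin-partialSum-comm m (suc n) e = begin
  sumFin m (λ a → partialSum (λ i → e i a) n + e n a)
    ≡⟨ sumFin-+ m _ (e n) ⟩
  sumFin m (λ a → partialSum (λ i → e i a) n) + sumFin m (e n)
    ≡⟨ cong (_+ sumFin m (e n)) (sumFin-partialSum-comm m n e) ⟩
  partialSum (λ i → sumFin m (e i)) n + sumFin m (e n) ∎

sumFin-reindex : ∀ m {P : Fin m → Set} (P? : Decidable P) (F : Fin m → ℤ) (h : ℕ → Fin m) n →
  (∀ {i j} → i < n → j < n → h i ≡ h j → i ≡ j) →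
  (∀ {i} → i < n → P (h i)) →
  (∀ {a} → P a → ∃[ i ] i < n × h i ≡ a) →
  sumFin m (λ a → if does (P? a) then F a else 0ℤ) ≡ partialSum (F ∘ h) n
sumFin-reindex m P? F h n h-injective h-into h-onto = begin
  sumFin m (λ a → if does (P? a) then F a else 0ℤ) ≡⟨ sumFin-cong m count-preimages ⟩
  sumFin m (λ a → partialSum (λ i → hit i a) n)      ≡⟨ sumFin-partialSum-comm m n hit ⟩
  partialSum (λ i → sumFin m (hit i)) n              ≡⟨ partialSum-cong n (λ {i} _ → sumFin-select m (h i) F) ⟩
  partialSum (F ∘ h) n                               ∎
  where
  hit : ℕ → Fin m → ℤ
  hit i a = if does (h i FinP.≟ a) then F a else 0ℤ

  miss : ∀ {i a} → h i ≢ a → hit i a ≡ 0ℤ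
  miss {i} {a} h≢a = cong (if_then F a else 0ℤ) (dec-false (h i FinP.≟ a) h≢a)

  count-preimages : ∀ a → (if does (P? a) then F a else 0ℤ) ≡ partialSum (λ i → hit i a) n
  count-preimages a with P? a
  ... | no ¬Pa = sym (partialSum-zero n λ i<n → miss λ hᵢ≡a → ¬Pa (subst _ hᵢ≡a (h-into i<n)))
  ... | yes Pa with h-onto Pa
  ...   | k , k<n , hₖ≡a = sym (begin
    partialSum (λ i → hit i a) n ≡⟨ partialSum-select n k<n (λ i<n i≢k → miss λ hᵢ≡a →
                                      i≢k (h-injective i<n k<n (trans hᵢ≡a (sym hₖ≡a)))) ⟩
    hit k a                      ≡⟨ cong (if_then F a else 0ℤ) (dec-true (h k FinP.≟ a) hₖ≡a) ⟩
    F a                          ∎)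

ℤ-induction : ∀ {p} (P : ℤ → Set p) → P 0ℤ →
              (∀ i → P i → P (ℤ.suc i)) → (∀ i → P (ℤ.suc i) → P i) → ∀ i → P i
ℤ-induction P p₀ up down (+ zero)       = p₀
ℤ-induction P p₀ up down (+ suc n)      = up (+ n) (ℤ-induction P p₀ up down (+ n))
ℤ-induction P p₀ up down -[1+ zero ]    = down -[1+ zero ] p₀
ℤ-induction P p₀ up down -[1+ suc n ]   = down -[1+ suc n ] (ℤ-induction P p₀ up down -[1+ n ])

same-increments⇒≗ : ∀ {F G : ℤ → ℤ} (d : ℤ → ℤ) → F 0ℤ ≡ G 0ℤ →
                    (∀ i → F (ℤ.suc i) ≡ F i + d i) → (∀ i → G (ℤ.suc i) ≡ G i + d i) →
                    ∀ i → F i ≡ G i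
same-increments⇒≗ {F} {G} d F₀≡G₀ F-suc G-suc = ℤ-induction (λ i → F i ≡ G i) F₀≡G₀ up down
  where
  up : ∀ i → F i ≡ G i → F (ℤ.suc i) ≡ G (ℤ.suc i)
  up i e = trans (F-suc i) (trans (cong (_+ d i) e) (sym (G-suc i)))
  down : ∀ i → F (ℤ.suc i) ≡ G (ℤ.suc i) → F i ≡ G i
  down i e = ∙-cancelʳ (d i) (F i) (G i) (trans (sym (F-suc i)) (trans e (G-suc i)))

neg-telescope : ∀ s x → - s ≡ - (s + x) + x
neg-telescope = solve-∀

antiderivative : (ℤ → ℤ) → ℤ → ℤ
antiderivative g (+ n)    = partialSum (g ∘ +_) n
antiderivative g -[1+ n ] = - partialSum (λ i → g -[1+ i ]) (suc n)

antiderivative-suc : ∀ g i → antiderivative g (ℤ.suc i) ≡ antiderivative g i + g i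
antiderivative-suc g (+ n)        = refl
antiderivative-suc g -[1+ zero ]  = neg-telescope 0ℤ (g -[1+ zero ])
antiderivative-suc g -[1+ suc n ] = neg-telescope (partialSum (λ i → g -[1+ i ]) (suc n)) (g -[1+ suc n ])

module _ {g : ℤ → ℤ} {P : ℤ} (periodic : ∀ i → g (i + P) ≡ g i) where

  antiderivative-+period : ∀ i → antiderivative g (i + P) ≡ antiderivative g i + antiderivative g P
  antiderivative-+period = same-increments⇒≗ g at-0 shifted-suc unshifted-suc
    where
    A = antiderivative g
    at-0 : A (0ℤ + P) ≡ 0ℤ + A P
    at-0 = trans (cong A (ℤP.+-identityˡ P)) (sym (ℤP.+-identityˡ (A P)))
    shifted-suc : ∀ i → A (ℤ.suc i + P) ≡ A (i + P) + g i
    shifted-suc i = begin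
      A (ℤ.suc i + P)     ≡⟨ cong A (ℤP.+-assoc 1ℤ i P) ⟩
      A (ℤ.suc (i + P))   ≡⟨ antiderivative-suc g (i + P) ⟩
      A (i + P) + g (i + P) ≡⟨ cong (_+_ (A (i + P))) (periodic i) ⟩
      A (i + P) + g i     ∎
    unshifted-suc : ∀ i → A (ℤ.suc i) + A P ≡ (A i + A P) + g i
    unshifted-suc i = trans (cong (_+ A P) (antiderivative-suc g i)) (xy∙z≈xz∙y (A i) (g i) (A P))

  antiderivative-*period : ∀ k → antiderivative g (k * P) ≡ k * antiderivative g P
  antiderivative-*period = same-increments⇒≗ (λ _ → A P) refl multiple-suc coefficient-suc
    where
    A = antiderivative g
    multiple-suc : ∀ k → A (ℤ.suc k * P) ≡ A (k * P) + A P
    multiple-suc k = begin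
      A (ℤ.suc k * P)  ≡⟨ cong A (trans (ℤP.suc-* k P) (ℤP.+-comm P (k * P))) ⟩
      A (k * P + P)    ≡⟨ antiderivative-+period (k * P) ⟩
      A (k * P) + A P  ∎
    coefficient-suc : ∀ k → ℤ.suc k * A P ≡ k * A P + A P
    coefficient-suc k = trans (ℤP.suc-* k (A P)) (ℤP.+-comm (A P) (k * A P))

module Powers {X : Set} (f f⁻¹ : X → X)
              (f∘f⁻¹ : ∀ x → f (f⁻¹ x) ≡ x) (f⁻¹∘f : ∀ x → f⁻¹ (f x) ≡ x) where

  f-injective : ∀ {x y} → f x ≡ f y → x ≡ y
  f-injective {x} {y} e = trans (sym (f⁻¹∘f x)) (trans (cong f⁻¹ e) (f⁻¹∘f y))

  iterℤ : ℤ → X → X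
  iterℤ (+ n)    = iter f n
  iterℤ -[1+ n ] = iter f⁻¹ (suc n)

  iterℤ-suc : ∀ i x → iterℤ (ℤ.suc i) x ≡ f (iterℤ i x)
  iterℤ-suc (+ n)        x = refl
  iterℤ-suc -[1+ zero ]  x = sym (f∘f⁻¹ x)
  iterℤ-suc -[1+ suc n ] x = sym (f∘f⁻¹ _)

  iterℤ-pred : ∀ i x → iterℤ (ℤ.pred i) x ≡ f⁻¹ (iterℤ i x)
  iterℤ-pred i x = begin
    iterℤ (ℤ.pred i) x               ≡⟨ f⁻¹∘f _ ⟨
    f⁻¹ (f (iterℤ (ℤ.pred i) x))     ≡⟨ cong f⁻¹ (iterℤ-suc (ℤ.pred i) x) ⟨
    f⁻¹ (iterℤ (ℤ.suc (ℤ.pred i)) x) ≡⟨ cong (λ j → f⁻¹ (iterℤ j x)) (ℤP.suc-pred i) ⟩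
    f⁻¹ (iterℤ i x)                  ∎

  iterℤ-+ : ∀ i j x → iterℤ (i + j) x ≡ iterℤ i (iterℤ j x)
  iterℤ-+ i j x = ℤ-induction (λ i → iterℤ (i + j) x ≡ iterℤ i (iterℤ j x))
                    (cong (λ k → iterℤ k x) (ℤP.+-identityˡ j))
                    (λ i e → trans (suc-+ i) (trans (cong f e) (sym (iterℤ-suc i (iterℤ j x)))))
                    (λ i e → f-injective (trans (sym (suc-+ i)) (trans e (iterℤ-suc i (iterℤ j x)))))
                    i
    where
    suc-+ : ∀ i → iterℤ (ℤ.suc i + j) x ≡ f (iterℤ (i + j) x)
    suc-+ i = trans (cong (λ k → iterℤ k x) (ℤP.+-assoc 1ℤ i j)) (iterℤ-suc (i + j) x)

  iterℤ-*-fixed : ∀ {P x} → iterℤ P x ≡ x → ∀ k → iterℤ (k * P) x ≡ x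
  iterℤ-*-fixed {P} {x} fixed = ℤ-induction (λ k → iterℤ (k * P) x ≡ x)
    (cong (λ k → iterℤ k x) (ℤP.*-zeroˡ P))
    (λ k e → trans (multiple-suc k) e)
    (λ k e → trans (sym (multiple-suc k)) e)
    where
    multiple-suc : ∀ k → iterℤ (ℤ.suc k * P) x ≡ iterℤ (k * P) x
    multiple-suc k = begin
      iterℤ (ℤ.suc k * P) x       ≡⟨ cong (λ j → iterℤ j x) (ℤP.suc-* k P) ⟩
      iterℤ (P + k * P) x         ≡⟨ cong (λ j → iterℤ j x) (ℤP.+-comm P (k * P)) ⟩
      iterℤ (k * P + P) x         ≡⟨ iterℤ-+ (k * P) P x ⟩
      iterℤ (k * P) (iterℤ P x)   ≡⟨ cong (iterℤ (k * P)) fixed ⟩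
      iterℤ (k * P) x             ∎

module Period {X : Set} (_≟_ : DecidableEquality X) (f f⁻¹ : X → X)
              (f∘f⁻¹ : ∀ x → f (f⁻¹ x) ≡ x) (f⁻¹∘f : ∀ x → f⁻¹ (f x) ≡ x)
              (x : X) (returns : ∃[ n ] iter f (suc n) x ≡ x) where

  open Powers f f⁻¹ f∘f⁻¹ f⁻¹∘f

  private
    minimal : ∃[ k ] iter f (suc k) x ≡ x × (∀ {j} → j < k → iter f (suc j) x ≢ x)
    minimal = least-witness (λ n → iter f (suc n) x ≟ x) {proj₁ returns} (proj₂ returns)

  period : ℕ
  period = suc (proj₁ minimal)

  iter-period : iter f period x ≡ x
  iter-period = proj₁ (proj₂ minimal)

  iter-fixed-below-period : ∀ {r} → r < period → iter f r x ≡ x → r ≡ 0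
  iter-fixed-below-period {zero}  _   _     = refl
  iter-fixed-below-period {suc r} r<p fixed = contradiction fixed (proj₂ (proj₂ minimal) (ℕP.≤-pred r<p))

  iterℤ-%period : ∀ i → iterℤ i x ≡ iter f (i %ℕ period) x
  iterℤ-%period i = begin
    iterℤ i x                                         ≡⟨ cong (λ j → iterℤ j x) (a≡a%ℕn+[a/ℕn]*n i period) ⟩
    iterℤ (+ r + q * + period) x                      ≡⟨ iterℤ-+ (+ r) (q * + period) x ⟩
    iter f r (iterℤ (q * + period) x)                 ≡⟨ cong (iter f r) (iterℤ-*-fixed iter-period q) ⟩
    iter f r x                                        ∎
    where
    r = i %ℕ period
    q = i /ℕ period

  iterℤ-fixed⇒multiple : ∀ {i} → iterℤ i x ≡ x → i ≡ (i /ℕ period) * + period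
  iterℤ-fixed⇒multiple {i} fixed = begin
    i                                      ≡⟨ a≡a%ℕn+[a/ℕn]*n i period ⟩
    + (i %ℕ period) + q * + period         ≡⟨ cong (λ r → + r + q * + period) remainder≡0 ⟩
    0ℤ + q * + period                      ≡⟨ ℤP.+-identityˡ (q * + period) ⟩
    q * + period                           ∎
    where
    q = i /ℕ period
    remainder≡0 : i %ℕ period ≡ 0
    remainder≡0 = iter-fixed-below-period (n%ℕd<d i period) (trans (sym (iterℤ-%period i)) fixed)

  private
    iter-injective-below-period-≤ : ∀ {i j} → i ≤ j → j < period → iter f i x ≡ iter f j x → i ≡ j
    iter-injective-below-period-≤ {i} {j} i≤j j<p e = ℕP.≤-antisym i≤j (ℕP.m∸n≡0⇒m≤n gap≡0)
      where
      gap-fixed : iter f (j ℕ.∸ i) x ≡ x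
      gap-fixed = iter-injective f f-injective i (begin
        iter f i (iter f (j ℕ.∸ i) x) ≡⟨ iter-+ f i (j ℕ.∸ i) x ⟨
        iter f (i ℕ.+ (j ℕ.∸ i)) x    ≡⟨ cong (λ k → iter f k x) (ℕP.m+[n∸m]≡n i≤j) ⟩
        iter f j x                    ≡⟨ e ⟨
        iter f i x                    ∎)
      gap≡0 : j ℕ.∸ i ≡ 0
      gap≡0 = iter-fixed-below-period (ℕP.≤-<-trans (ℕP.m∸n≤m j i) j<p) gap-fixed

  iter-injective-below-period : ∀ {i j} → i < period → j < period → iter f i x ≡ iter f j x → i ≡ j
  iter-injective-below-period {i} {j} i<p j<p e with ℕP.≤-total i j
  ... | inj₁ i≤j = iter-injective-below-period-≤ i≤j j<p e
  ... | inj₂ j≤i = sym (iter-injective-below-period-≤ j≤i i<p (sym e))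

module _ {n : ℕ} where

  FiredAt : Fin n → ℤ → (Fin n → ℤ) → (Fin n → ℤ) → Set
  FiredAt u z J J′ = (∀ v → v ≢ u → J′ v ≡ J v) × J′ u ≡ z + J u

  fireAt : Fin n → ℤ → (Fin n → ℤ) → Fin n → ℤ
  fireAt u z J v = if does (v FinP.≟ u) then z + J v else J v

  fireAt-FiredAt : ∀ u z J → FiredAt u z J (fireAt u z J)
  fireAt-FiredAt u z J = (λ v v≢u → cong (if_then z + J v else J v) (dec-false (v FinP.≟ u) v≢u))
                       , cong (if_then z + J u else J u) (dec-true (u FinP.≟ u) refl)

  FiredAt-zero : ∀ {u J J′} → FiredAt u 0ℤ J J′ → ∀ v → J v ≡ J′ v
  FiredAt-zero {u} {J} (off-u , at-u) v with v FinP.≟ u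
  ... | yes refl = sym (trans at-u (ℤP.+-identityˡ (J v)))
  ... | no v≢u   = sym (off-u v v≢u)

  FiredAt-split : ∀ {u z z′ J J′ J″} →
                  FiredAt u (z′ + z) J J″ → FiredAt u z J J′ → FiredAt u z′ J′ J″
  FiredAt-split {u} {z} {z′} {J} {J′} {J″} (off-u″ , at-u″) (off-u′ , at-u′) =
    (λ v v≢u → trans (off-u″ v v≢u) (sym (off-u′ v v≢u))) , (begin
      J″ u            ≡⟨ at-u″ ⟩
      (z′ + z) + J u  ≡⟨ ℤP.+-assoc z′ z (J u) ⟩
      z′ + (z + J u)  ≡⟨ cong (_+_ z′) at-u′ ⟨
      z′ + J′ u       ∎)

  firings : ∀ j → (Fin j → Fin n) → (Fin j → ℤ) → Fin n → ℤ
  firings j ι r v = sumFin j (λ i → if does (v FinP.≟ ι i) then r i else 0ℤ)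

  firings-suc : ∀ j ι r (J : Fin n → ℤ) →
    FiredAt (ι Fin.zero) (r Fin.zero) (λ v → J v + firings j (ι ∘ Fin.suc) (r ∘ Fin.suc) v)
                                      (λ v → J v + firings (suc j) ι r v)
  firings-suc j ι r J = off-ι₀ , at-ι₀
    where
    rest = firings j (ι ∘ Fin.suc) (r ∘ Fin.suc)
    off-ι₀ : ∀ v → v ≢ ι Fin.zero → J v + firings (suc j) ι r v ≡ J v + rest v
    off-ι₀ v v≢ι₀ = cong (_+_ (J v)) (trans (cong (λ t → (if t then r Fin.zero else 0ℤ) + rest v)
                                                  (dec-false (v FinP.≟ ι Fin.zero) v≢ι₀))
                                            (ℤP.+-identityˡ (rest v)))
    at-ι₀ : J (ι Fin.zero) + firings (suc j) ι r (ι Fin.zero)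
              ≡ r Fin.zero + (J (ι Fin.zero) + rest (ι Fin.zero))
    at-ι₀ = trans (cong (λ t → J (ι Fin.zero) + ((if t then r Fin.zero else 0ℤ) + rest (ι Fin.zero)))
                        (dec-true (ι Fin.zero FinP.≟ ι Fin.zero) refl))
                  (x∙yz≈y∙xz (J (ι Fin.zero)) (r Fin.zero) (rest (ι Fin.zero)))

module Lifting (G : RotorGraph) (β : RotorMap G) (β-rotor : IsRotorConfig G β) where
  open RotorGraph G
  open Powers θ θ⁻ θ-θ⁻ θ⁻-θ

  returns : ∀ u → ∃[ n ] iter θ (suc n) (β u) ≡ β u
  returns u with θ-cycle (θ (β u)) (β u) (θ-tail (β u))
  ... | n , e = n , trans (sym (iter-comm θ n (β u))) e

  module _ (u : Fin n₀) where
    open Period FinP._≟_ θ θ⁻ θ-θ⁻ θ⁻-θ (β u) (returns u) public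
      using (period; iter-period; iterℤ-%period; iterℤ-fixed⇒multiple; iter-injective-below-period)

  tail-iter : ∀ i a → tail (iter θ i a) ≡ tail a
  tail-iter zero    a = refl
  tail-iter (suc i) a = trans (θ-tail _) (tail-iter i a)

  orbit-onto : ∀ u {a} → tail a ≡ u → ∃[ i ] i < period u × iter θ i (β u) ≡ a
  orbit-onto u {a} tail≡u with θ-cycle (β u) a (trans (β-rotor u) (sym tail≡u))
  ... | j , e = + j %ℕ period u , n%ℕd<d (+ j) (period u) , trans (sym (iterℤ-%period u (+ j))) e

  sum-out-arcs≡orbit-sum : ∀ u (F : A → ℤ) →
    sumFin m (λ a → if does (tail a FinP.≟ u) then F a else 0ℤ)
      ≡ partialSum (λ i → F (iter θ i (β u))) (period u)
  sum-out-arcs≡orbit-sum u F =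
    sumFin-reindex m (λ a → tail a FinP.≟ u) F (λ i → iter θ i (β u)) (period u)
      (iter-injective-below-period u) (λ {i} _ → trans (tail-iter i (β u)) (β-rotor u)) (orbit-onto u)

  position : FiringVector G → RotorMap G
  position J u = iterℤ (J u) (β u)

  displacement : Fin n₀ → ℤ → ParticleConfig G
  displacement u j w = antiderivative (λ i → δ G (head (iterℤ i (β u))) w - δ G (inj₁ u) w) j

  displacement-*period : ∀ u k w → displacement u (k * + period u) w ≡ k * Δ₁ G u w
  displacement-*period u k w = begin
    displacement u (k * + period u) w    ≡⟨ antiderivative-*period periodic k ⟩
    k * displacement u (+ period u) w    ≡⟨ cong (k *_) (sum-out-arcs≡orbit-sum u sent) ⟨
    k * Δ₁ G u w                         ∎
    where
    sent : A → ℤ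
    sent a = δ G (head a) w - δ G (inj₁ u) w
    periodic : ∀ i → sent (iterℤ (i + + period u) (β u)) ≡ sent (iterℤ i (β u))
    periodic i = cong sent (trans (iterℤ-+ i (+ period u) (β u)) (cong (iterℤ i) (iter-period u)))

  infix 4 _≈_
  _≈_ : State G → State G → Set
  _≈_ = _≈S_ G

  ≈-trans : ∀ {s t t′} → s ≈ t → t ≈ t′ → s ≈ t′
  ≈-trans (ρ≡ , σ≡) (ρ≡′ , σ≡′) = (λ u → trans (ρ≡ u) (ρ≡′ u)) , (λ w → trans (σ≡ w) (σ≡′ w))

  module _ (σ : ParticleConfig G) where

    lift : FiringVector G → State G
    lift J = position J , λ w → σ w + sumFin n₀ (λ u → displacement u (J u) w)

    lift-cong : ∀ {s J J′} → (∀ u → J u ≡ J′ u) → s ≈ lift J → s ≈ lift J′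
    lift-cong J≗J′ (rotors , particles) =
      (λ u → trans (rotors u) (cong (λ j → iterℤ j (β u)) (J≗J′ u))) ,
      (λ w → trans (particles w)
                   (cong (_+_ (σ w)) (sumFin-cong n₀ λ u → cong (λ j → displacement u j w) (J≗J′ u))))

    lift-*period : ∀ k → lift (λ u → k u * + period u) ≈ (β , λ w → σ w + Δ G k w)
    lift-*period k =
      (λ u → iterℤ-*-fixed (iter-period u) (k u)) ,
      (λ w → cong (_+_ (σ w)) (sumFin-cong n₀ λ u → displacement-*period u (k u) w))

    lift-step : ∀ {u J J′ ρ τ} a τ′ → (∀ v → v ≢ u → J′ v ≡ J v) → (ρ , τ) ≈ lift J →
                a ≡ iterℤ (J′ u) (β u) →
                (∀ w → τ′ w ≡ τ w + (displacement u (J′ u) w - displacement u (J u) w)) →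
                (update G ρ u a , τ′) ≈ lift J′
    lift-step {u} {J} {J′} {ρ} {τ} a τ′ off-u (rotors , particles) a≡ τ′≡ = rotors′ , particles′
      where
      rotors′ : ∀ v → update G ρ u a v ≡ iterℤ (J′ v) (β v)
      rotors′ v with v FinP.≟ u
      ... | yes refl = a≡
      ... | no v≢u   = trans (rotors v) (cong (λ j → iterℤ j (β v)) (sym (off-u v v≢u)))
      particles′ : ∀ w → τ′ w ≡ σ w + sumFin n₀ (λ v → displacement v (J′ v) w)
      particles′ w = begin
        τ′ w                                  ≡⟨ τ′≡ w ⟩
        τ w + (D′ u - D u)                    ≡⟨ cong (_+ (D′ u - D u)) (particles w) ⟩
        (σ w + sumFin n₀ D) + (D′ u - D u)    ≡⟨ ℤP.+-assoc (σ w) _ _ ⟩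
        σ w + (sumFin n₀ D + (D′ u - D u))    ≡⟨ cong (_+_ (σ w)) (sumFin-update n₀ u D D′ λ v v≢u →
                                                   cong (λ j → displacement v j w) (off-u v v≢u)) ⟨
        σ w + sumFin n₀ D′                    ∎
        where
        D D′ : Fin n₀ → ℤ
        D  v = displacement v (J v) w
        D′ v = displacement v (J′ v) w

    routing⁺-lift : ∀ {u J J′ s} → FiredAt u 1ℤ J J′ → s ≈ lift J → routing⁺ G u s ≈ lift J′
    routing⁺-lift {u} {J} {J′} {ρ , τ} (off-u , J′u≡) lifted@(rotors , _) =
      lift-step _ _ off-u lifted rotor particles
      where
      rotor : θ (ρ u) ≡ iterℤ (J′ u) (β u)
      rotor = begin
        θ (ρ u)                     ≡⟨ cong θ (rotors u) ⟩
        θ (iterℤ (J u) (β u))       ≡⟨ iterℤ-suc (J u) (β u) ⟨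
        iterℤ (ℤ.suc (J u)) (β u)   ≡⟨ cong (λ j → iterℤ j (β u)) J′u≡ ⟨
        iterℤ (J′ u) (β u)          ∎
      particles : ∀ w → τ w + δ G (head (ρ u)) w - δ G (inj₁ u) w
                      ≡ τ w + (displacement u (J′ u) w - displacement u (J u) w)
      particles w = begin
        τ w + δ G (head (ρ u)) w - d               ≡⟨ cong (λ a → τ w + δ G (head a) w - d) (rotors u) ⟩
        τ w + h - d                                ≡⟨ gain-one-step (τ w) D h d ⟩
        τ w + ((D + (h - d)) - D)                  ≡⟨ cong (λ t → τ w + (t - D)) (antiderivative-suc _ (J u)) ⟨
        τ w + (displacement u (ℤ.suc (J u)) w - D) ≡⟨ cong (λ j → τ w + (displacement u j w - D)) J′u≡ ⟨
        τ w + (displacement u (J′ u) w - D)        ∎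
        where
        D = displacement u (J u) w
        h = δ G (head (iterℤ (J u) (β u))) w
        d = δ G (inj₁ u) w
        gain-one-step : ∀ t D h d → t + h - d ≡ t + ((D + (h - d)) - D)
        gain-one-step = solve-∀

    routing⁻-lift : ∀ {u J J′ s} → FiredAt u -1ℤ J J′ → s ≈ lift J → routing⁻ G u s ≈ lift J′
    routing⁻-lift {u} {J} {J′} {ρ , τ} (off-u , J′u≡) lifted@(rotors , _) =
      lift-step _ _ off-u lifted rotor particles
      where
      rotor : θ⁻ (ρ u) ≡ iterℤ (J′ u) (β u)
      rotor = begin
        θ⁻ (ρ u)                    ≡⟨ cong θ⁻ (rotors u) ⟩
        θ⁻ (iterℤ (J u) (β u))      ≡⟨ iterℤ-pred (J u) (β u) ⟨
        iterℤ (ℤ.pred (J u)) (β u)  ≡⟨ cong (λ j → iterℤ j (β u)) J′u≡ ⟨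
        iterℤ (J′ u) (β u)          ∎
      Ju≡ : J u ≡ ℤ.suc (J′ u)
      Ju≡ = trans (sym (ℤP.suc-pred (J u))) (cong ℤ.suc (sym J′u≡))
      particles : ∀ w → τ w - δ G (head (θ⁻ (ρ u))) w + δ G (inj₁ u) w
                      ≡ τ w + (displacement u (J′ u) w - displacement u (J u) w)
      particles w = begin
        τ w - δ G (head (θ⁻ (ρ u))) w + d           ≡⟨ cong (λ a → τ w - δ G (head a) w + d) rotor ⟩
        τ w - h + d                                 ≡⟨ lose-one-step (τ w) D′ h d ⟩
        τ w + (D′ - (D′ + (h - d)))                 ≡⟨ cong (λ t → τ w + (D′ - t)) (antiderivative-suc _ (J′ u)) ⟨
        τ w + (D′ - displacement u (ℤ.suc (J′ u)) w) ≡⟨ cong (λ j → τ w + (D′ - displacement u j w)) Ju≡ ⟨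
        τ w + (D′ - displacement u (J u) w)         ∎
        where
        D′ = displacement u (J′ u) w
        h = δ G (head (iterℤ (J′ u) (β u))) w
        d = δ G (inj₁ u) w
        lose-one-step : ∀ t D h d → t - h + d ≡ t + (D - (D + (h - d)))
        lose-one-step = solve-∀

    iterate-lift : ∀ {u} (move : State G → State G) c →
                   (∀ {J J′ s} → FiredAt u c J J′ → s ≈ lift J → move s ≈ lift J′) →
                   ∀ n {J J′ s} → FiredAt u (+ n * c) J J′ → s ≈ lift J → iter move n s ≈ lift J′
    iterate-lift {u} move c move-lift zero {J} {J′} fired lifted =
      lift-cong (FiredAt-zero (subst (λ z → FiredAt u z J J′) (ℤP.*-zeroˡ c) fired)) lifted
    iterate-lift {u} move c move-lift (suc n) {J} fired lifted =
      move-lift (FiredAt-split {z = + n * c} {z′ = c} (subst (λ z → FiredAt u z J _) (ℤP.suc-* (+ n) c) fired)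
                                                     (fireAt-FiredAt u (+ n * c) J))
                (iterate-lift move c move-lift n (fireAt-FiredAt u (+ n * c) J) lifted)

    routingPow-lift : ∀ {u} z {J J′ s} → FiredAt u z J J′ → s ≈ lift J → routingPow G u z s ≈ lift J′
    routingPow-lift {u} (+ n) {J} {J′} fired =
      iterate-lift (routing⁺ G u) 1ℤ routing⁺-lift n
                   (subst (λ z → FiredAt u z J J′) (sym (ℤP.*-identityʳ (+ n))) fired)
    routingPow-lift {u} -[1+ n ] {J} {J′} fired =
      iterate-lift (routing⁻ G u) -1ℤ routing⁻-lift (suc n)
                   (subst (λ z → FiredAt u z J J′) (sym n*-1≡-n) fired)
      where
      n*-1≡-n : + suc n * -1ℤ ≡ -[1+ n ]
      n*-1≡-n = trans (ℤP.*-comm (+ suc n) -1ℤ) (ℤP.-1*i≡-i (+ suc n))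

    routingAux-lift : ∀ j ι r {J s} → s ≈ lift J →
                      routingAux G j ι r s ≈ lift (λ v → J v + firings j ι r v)
    routingAux-lift zero    ι r {J} lifted = lift-cong (λ v → sym (ℤP.+-identityʳ (J v))) lifted
    routingAux-lift (suc j) ι r {J} lifted =
      routingPow-lift (r Fin.zero) (firings-suc j ι r J)
                      (routingAux-lift j (ι ∘ Fin.suc) (r ∘ Fin.suc) {J} lifted)

    lift-zero : (β , σ) ≈ lift (λ _ → 0ℤ)
    lift-zero = (λ _ → refl) ,
                (λ w → sym (trans (cong (_+_ (σ w)) (sumFin-zero n₀)) (ℤP.+-identityʳ (σ w))))

    routing-lift : ∀ r → routing G r (β , σ) ≈ lift r
    routing-lift r = lift-cong (λ v → trans (ℤP.+-identityˡ _) (sumFin-select n₀ v r))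
                               (routingAux-lift n₀ (λ u → u) r {λ _ → 0ℤ} lift-zero)

    ∼S⇒Δ-difference : ∀ {σ′} → _∼S_ G (β , σ) (β , σ′) → ∃[ q ] (∀ w → σ′ w ≡ σ w + Δ G q w)
    ∼S⇒Δ-difference {σ′} (r , rotors-back , particles-back) = q , λ w → begin
      σ′ w                          ≡⟨ particles-back w ⟨
      proj₂ (routing G r (β , σ)) w ≡⟨ proj₂ (≈-trans lifted (lift-*period q)) w ⟩
      σ w + Δ G q w                 ∎
      where
      q : FiringVector G
      q u = r u /ℕ period u
      lifted : routing G r (β , σ) ≈ lift (λ u → q u * + period u)
      lifted = lift-cong {J = r} (λ u → iterℤ-fixed⇒multiple u (trans (sym (proj₁ (routing-lift r) u))
                                                                       (rotors-back u)))
                         (routing-lift r)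

    Δ-difference⇒∼S : ∀ {σ′} r → (∀ w → σ′ w ≡ σ w + Δ G r w) → _∼S_ G (β , σ) (β , σ′)
    Δ-difference⇒∼S r σ′≡ =
      (λ u → r u * + period u) ,
      ≈-trans (routing-lift _) (≈-trans (lift-*period r) ((λ _ → refl) , (λ w → sym (σ′≡ w))))

proposition3 : (G : RotorGraph) → (σ σ' : ParticleConfig G) →
    _∼_ G σ σ' ⇔ (∃[ r ] ((v : RotorGraph.V G) → σ' v ≡ σ v + Δ G r v))
proposition3 G σ σ' = mk⇔ forward backward
  where
  open RotorGraph G using (nonsink)
  forward : _∼_ G σ σ' → ∃[ r ] ((v : RotorGraph.V G) → σ' v ≡ σ v + Δ G r v)
  forward (ρ , ρ-rotor , ρσ∼ρσ') = Lifting.∼S⇒Δ-difference G ρ ρ-rotor σ ρσ∼ρσ'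
  backward : ∃[ r ] ((v : RotorGraph.V G) → σ' v ≡ σ v + Δ G r v) → _∼_ G σ σ'
  backward (r , σ'≡) = β , β-rotor , Lifting.Δ-difference⇒∼S G β β-rotor σ r σ'≡
    where
    β : RotorMap G
    β u = proj₁ (nonsink u)
    β-rotor : IsRotorConfig G β
    β-rotor u = proj₂ (nonsink u)
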